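{- Let $p$ be a prime and let $f\ge 2$ be an integer. Then $\binom{p^f-1}{p^{f-1}}\equiv p-1 \pmod{p^2}$ if $p\ge 3$, and $\binom{2^f-1}{2^{f-1}}\equiv 3 \pmod{4}$ if $p=2$. -}

module Defs where

open import Data.Nat using (ℕ)
open import Data.Integer using (ℤ; +_; _-_)
open import Data.Integer.Divisibility using (_∣_)

infix 4 _≡_[mod_]
_≡_[mod_] : ℕ → ℕ → ℕ → Set
a ≡ b [mod m ] = (+ m) ∣ ((+ a) - (+ b))

module Submission where

-- Write D(g) = C(p^(g+1) - 1, p^g), so the theorem is about D(f-1) modulo p².
--
-- For n = pH, the binomial coefficient C(n-1, pj) splits into a "p-adic part"
-- and a "unit part":
--     C(pH-1, pj) · ∏'_{i ≤ pj} i  =  C(H-1, j) · ∏'_{i ≤ pj} (pH - i),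
-- where ∏' runs over the 1 ≤ i ≤ pj prime to p.  This is proved by walking k
-- from 0 to pj one step at a time (block induction), using the absorption
-- identity (k+1)·C(N,k+1) = (N-k)·C(N,k) at every step.
-- When p² divides pH, every factor pH - i is ≡ -i modulo p², so the right-hand
-- product is ≡ (-1)^((p-1)j) times the left-hand one; the latter is prime to p
-- and cancels.  With H = p^(g+1), j = p^g this gives
--     D(g+1) ≡ (-1)^((p-1)p^g) · D(g)   (mod p²).
-- The sign is +1 when p is odd, and also when p = 2 and g ≥ 1.  Hence D is
-- constant modulo p² from D(0) = C(p-1,1) = p-1 on (p odd), resp. from
-- D(1) = C(3,2) = 3 on (p = 2).

open import Defs
open import Data.Nat using (ℕ; zero; suc; _+_; _*_; _∸_; _^_; _≤_; _<_; z≤n; s≤s; NonZero; >-nonZero⁻¹; nonTrivial⇒≢1; _!)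
open import Data.Nat.Properties
open import Data.Nat.DivMod using (m/n*n≡m)
open import Data.Nat.Divisibility as ℕ using (_∣_; _∣?_; divides)
open import Data.Nat.Primality using (Prime; composite; euclidsLemma; prime⇒nonZero; prime⇒nonTrivial; prime[2])
open import Data.Nat.Combinatorics using (_C_; nC1≡n; k![n∸k]!∣n!; [n-k]*[n-k-1]!≡[n-k]!)
open import Data.Nat.Combinatorics.Specification using (nCk≡n!/k![n-k]!; k>n⇒nCk≡0)
open import Data.Nat.Tactic.RingSolver using (solve-∀)
open import Data.Integer as ℤ using (ℤ; +_; -_; -1ℤ; 1ℤ)
import Data.Integer.Properties as ℤProp
import Data.Integer.Divisibility.Signed as ℤDiv
import Data.Integer.Tactic.RingSolver as ℤRing
open import Data.Bool using (if_then_else_)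
open import Data.Product using (_×_; _,_)
open import Data.Sum using (_⊎_; inj₁; inj₂; [_,_]′)
open import Data.Empty using (⊥-elim)
open import Function using (id)
open import Relation.Nullary using (¬_; does; yes; no)
open import Relation.Nullary.Decidable using (dec-true; dec-false)
open import Relation.Binary.PropositionalEquality

choose-factorials : ∀ {N k} → k ≤ N → (N C k) * (k ! * (N ∸ k) !) ≡ N !
choose-factorials {N} {k} k≤N = trans (cong (_* (k ! * (N ∸ k) !)) (nCk≡n!/k![n-k]! k≤N))
  (m/n*n≡m {{k !* (N ∸ k) !≢0}} (k![n∸k]!∣n! k≤N))

-- The absorption identity (k+1)·C(N,k+1) = (N-k)·C(N,k); for k ≥ N both sides vanish.
choose-absorption : ∀ N k → suc k * (N C suc k) ≡ (N ∸ k) * (N C k)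
choose-absorption N k with k <? N
... | yes k<N = *-cancelʳ-≡ _ _ (k ! * (N ∸ suc k) !) {{k !* (N ∸ suc k) !≢0}} (begin
    (suc k * (N C suc k)) * (k ! * (N ∸ suc k) !)    ≡⟨ regroup₁ (N C suc k) (suc k) (k !) ((N ∸ suc k) !) ⟩
    (N C suc k) * (suc k ! * (N ∸ suc k) !)          ≡⟨ choose-factorials k<N ⟩
    N !                                              ≡⟨ choose-factorials (<⇒≤ k<N) ⟨
    (N C k) * (k ! * (N ∸ k) !)                      ≡⟨ cong (λ z → (N C k) * (k ! * z)) ([n-k]*[n-k-1]!≡[n-k]! k<N) ⟨
    (N C k) * (k ! * ((N ∸ k) * (N ∸ suc k) !))      ≡⟨ regroup₂ (N C k) (N ∸ k) (k !) ((N ∸ suc k) !) ⟩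
    ((N ∸ k) * (N C k)) * (k ! * (N ∸ suc k) !)      ∎)
  where
  open ≡-Reasoning
  regroup₁ : ∀ c m a b → (m * c) * (a * b) ≡ c * ((m * a) * b)
  regroup₁ = solve-∀
  regroup₂ : ∀ c m a b → c * (a * (m * b)) ≡ (m * c) * (a * b)
  regroup₂ = solve-∀
... | no k≮N rewrite k>n⇒nCk≡0 {N} {suc k} (s≤s (≮⇒≥ k≮N)) | m≤n⇒m∸n≡0 (≮⇒≥ k≮N) = *-zeroʳ (suc k)

-- x ≡ y (mod m) for integers: m divides x - y.  (A record, so that x, y and m
-- can be inferred from a goal.)
infix 4 _≡ᶻ_[mod_]
record _≡ᶻ_[mod_] (x y : ℤ) (m : ℕ) : Set where
  constructor mod-divides
  field difference : + m ℤDiv.∣ x ℤ.- y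

module _ {m : ℕ} where

  ≡ᶻ-reflexive : ∀ {x y} → x ≡ y → x ≡ᶻ y [mod m ]
  ≡ᶻ-reflexive {x} refl = mod-divides (subst (+ m ℤDiv.∣_) (sym (ℤProp.+-inverseʳ x)) (ℤDiv.divides (+ 0) refl))

  ≡ᶻ-trans : ∀ {x y z} → x ≡ᶻ y [mod m ] → y ≡ᶻ z [mod m ] → x ≡ᶻ z [mod m ]
  ≡ᶻ-trans {x} {y} {z} (mod-divides x≡y) (mod-divides y≡z) =
    mod-divides (subst (+ m ℤDiv.∣_) (telescope x y z) (ℤDiv.∣m∣n⇒∣m+n x≡y y≡z))
    where
    telescope : ∀ x y z → (x ℤ.- y) ℤ.+ (y ℤ.- z) ≡ x ℤ.- z
    telescope = ℤRing.solve-∀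

  ≡ᶻ-*-cong : ∀ {x y u v} → x ≡ᶻ y [mod m ] → u ≡ᶻ v [mod m ] → x ℤ.* u ≡ᶻ y ℤ.* v [mod m ]
  ≡ᶻ-*-cong {x} {y} {u} {v} (mod-divides x≡y) (mod-divides u≡v) =
    mod-divides (subst (+ m ℤDiv.∣_) (split x y u v) (ℤDiv.∣m∣n⇒∣m+n (ℤDiv.∣n⇒∣m*n x u≡v) (ℤDiv.∣m⇒∣m*n v x≡y)))
    where
    split : ∀ x y u v → x ℤ.* (u ℤ.- v) ℤ.+ (x ℤ.- y) ℤ.* v ≡ x ℤ.* u ℤ.- y ℤ.* v
    split = ℤRing.solve-∀

  complement-≡ᶻ : ∀ {n i} → m ∣ n → i ≤ n → + (n ∸ i) ≡ᶻ - + i [mod m ]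
  complement-≡ᶻ {n} {i} m∣n i≤n = mod-divides (subst (+ m ℤDiv.∣_) (sym n∸i+i) (ℤDiv.∣ᵤ⇒∣ m∣n))
    where
    cancel : ∀ a b → (a ℤ.- b) ℤ.- (- b) ≡ a
    cancel = ℤRing.solve-∀
    n∸i+i : + (n ∸ i) ℤ.- (- + i) ≡ + n
    n∸i+i = trans (cong (ℤ._- (- + i)) (trans (sym (ℤProp.⊖-≥ i≤n)) (sym (ℤProp.[+m]-[+n]≡m⊖n n i))))
                       (cancel (+ n) (+ i))

≡ᶻ⇒≡[mod] : ∀ {a b m} → + a ≡ᶻ + b [mod m ] → a ≡ b [mod m ]
≡ᶻ⇒≡[mod] (mod-divides m∣a-b) = ℤDiv.∣⇒∣ᵤ m∣a-b

prime-power-cancel : ∀ {p a y} → Prime p → ¬ p ∣ a → ∀ e → p ^ e ∣ a * y → p ^ e ∣ y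
prime-power-cancel {y = y} _ _ zero _ = ℕ.1∣ y
prime-power-cancel {p} {a} {y} p-prime p∤a (suc e) pᵉ⁺¹∣ay
  with euclidsLemma a y p-prime (ℕ.∣-trans (ℕ.m∣m*n (p ^ e)) pᵉ⁺¹∣ay)
... | inj₁ p∣a = ⊥-elim (p∤a p∣a)
... | inj₂ (divides z refl) = subst (_∣ z * p) (*-comm (p ^ e) p) (ℕ.*-monoˡ-∣ p pᵉ∣z)
  where
  instance _ = prime⇒nonZero p-prime
  pᵉ∣az : p ^ e ∣ a * z
  pᵉ∣az = ℕ.*-cancelʳ-∣ p (subst₂ _∣_ (*-comm p (p ^ e)) (sym (*-assoc a z p)) pᵉ⁺¹∣ay)
  pᵉ∣z : p ^ e ∣ z
  pᵉ∣z = prime-power-cancel p-prime p∤a e pᵉ∣az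

≡ᶻ-cancel : ∀ {p a x y e} → Prime p → ¬ p ∣ a →
            + a ℤ.* x ≡ᶻ + a ℤ.* y [mod p ^ e ] → x ≡ᶻ y [mod p ^ e ]
≡ᶻ-cancel {p} {a} {x} {y} {e} p-prime p∤a (mod-divides ax≡ay) = mod-divides (ℤDiv.∣ᵤ⇒∣ (prime-power-cancel p-prime p∤a e
  (subst (p ^ e ∣_) (trans (cong ℤ.∣_∣ (factor (+ a) x y)) (ℤProp.abs-* (+ a) (x ℤ.- y))) (ℤDiv.∣⇒∣ᵤ ax≡ay))))
  where
  factor : ∀ a x y → a ℤ.* x ℤ.- a ℤ.* y ≡ a ℤ.* (x ℤ.- y)
  factor = ℤRing.solve-∀

module UnitProducts (p : ℕ) where

  unitProduct : (ℕ → ℕ) → ℕ → ℕ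
  unitProduct f zero    = 1
  unitProduct f (suc k) = if does (p ∣? suc k) then unitProduct f k else unitProduct f k * f (suc k)

  unitCount : ℕ → ℕ
  unitCount zero    = 0
  unitCount (suc k) = if does (p ∣? suc k) then unitCount k else suc (unitCount k)

  unitProduct-skip : ∀ f {k} → p ∣ suc k → unitProduct f (suc k) ≡ unitProduct f k
  unitProduct-skip f {k} p∣ rewrite dec-true (p ∣? suc k) p∣ = refl

  unitProduct-take : ∀ f {k} → ¬ p ∣ suc k → unitProduct f (suc k) ≡ unitProduct f k * f (suc k)
  unitProduct-take f {k} p∤ rewrite dec-false (p ∣? suc k) p∤ = refl

  unitCount-skip : ∀ {k} → p ∣ suc k → unitCount (suc k) ≡ unitCount k
  unitCount-skip {k} p∣ rewrite dec-true (p ∣? suc k) p∣ = refl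

  unitCount-take : ∀ {k} → ¬ p ∣ suc k → unitCount (suc k) ≡ suc (unitCount k)
  unitCount-take {k} p∤ rewrite dec-false (p ∣? suc k) p∤ = refl

  negate-factors : ∀ {m} f g k → (∀ i → i ≤ k → + f i ≡ᶻ - + g i [mod m ]) →
                   + unitProduct f k ≡ᶻ -1ℤ ℤ.^ unitCount k ℤ.* + unitProduct g k [mod m ]
  negate-factors f g zero    _     = ≡ᶻ-reflexive refl
  negate-factors f g (suc k) f≡-g
    with p ∣? suc k | negate-factors f g k (λ i i≤k → f≡-g i (m≤n⇒m≤1+n i≤k))
  ... | yes _ | previous = previous
  ... | no _  | previous = ≡ᶻ-trans (≡ᶻ-reflexive (ℤProp.pos-* (unitProduct f k) (f (suc k))))
    (≡ᶻ-trans (≡ᶻ-*-cong previous (f≡-g (suc k) ≤-refl)) (≡ᶻ-reflexive one-more-sign))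
    where
    regroup : ∀ s a b → (s ℤ.* a) ℤ.* (- b) ≡ (-1ℤ ℤ.* s) ℤ.* (a ℤ.* b)
    regroup = ℤRing.solve-∀
    one-more-sign : (-1ℤ ℤ.^ unitCount k ℤ.* + unitProduct g k) ℤ.* (- + g (suc k))
                    ≡ -1ℤ ℤ.^ suc (unitCount k) ℤ.* + (unitProduct g k * g (suc k))
    one-more-sign = trans (regroup (-1ℤ ℤ.^ unitCount k) (+ unitProduct g k) (+ g (suc k)))
                          (cong (-1ℤ ℤ.^ suc (unitCount k) ℤ.*_) (sym (ℤProp.pos-* (unitProduct g k) (g (suc k)))))

module Blocks (p : ℕ) .{{_ : NonZero p}} where
  open UnitProducts p

  between-multiples : ∀ j r → suc r < p → ¬ p ∣ suc (p * j + r)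
  between-multiples j r r+1<p p∣ = <⇒≱ r+1<p
    (ℕ.∣⇒≤ (ℕ.∣m+n∣m⇒∣n (subst (p ∣_) (sym (+-suc (p * j) r)) p∣) (ℕ.m∣m*n j)))

  block-end : ∀ j → suc (p * j + (p ∸ 1)) ≡ p * suc j
  block-end j = begin
    suc (p * j + (p ∸ 1))  ≡⟨ +-suc (p * j) (p ∸ 1) ⟨
    p * j + suc (p ∸ 1)    ≡⟨ cong (λ z → p * j + z) (suc-pred p) ⟩
    p * j + p              ≡⟨ +-comm (p * j) p ⟩
    p + p * j              ≡⟨ *-suc p j ⟨
    p * suc j              ∎
    where open ≡-Reasoning

  -- Induction along k = 0, 1, 2, … while tracking the quotient j = ⌊k/p⌋:
  -- a property of (k, j) that holds at (0, 0), survives every step onto a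
  -- non-multiple of p, and survives every step onto p(j+1) when j is increased,
  -- holds at every (pj, j).
  blockInduction : (P : ℕ → ℕ → Set) → P 0 0 →
                   (∀ {k j} → ¬ p ∣ suc k → P k j → P (suc k) j) →
                   (∀ {k j} → suc k ≡ p * suc j → P k j → P (suc k) (suc j)) →
                   ∀ j → P (p * j) j
  blockInduction P start inside boundary j = subst (λ k → P k j) (+-identityʳ (p * j)) (within j 0 (>-nonZero⁻¹ p))
    where
    within : ∀ j r → r < p → P (p * j + r) j
    within zero    zero    _     = subst (λ k → P k 0) (sym (trans (+-identityʳ (p * 0)) (*-zeroʳ p))) start
    within j       (suc r) r+1<p = subst (λ k → P k j) (sym (+-suc (p * j) r))
                                   (inside (between-multiples j r r+1<p) (within j r (<⇒≤ r+1<p)))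
    within (suc j) zero    _     = subst (λ k → P k (suc j)) (trans (block-end j) (sym (+-identityʳ (p * suc j))))
                                   (boundary (block-end j) (within j (p ∸ 1) (≤-reflexive (suc-pred p))))

  boundary-divisible : ∀ {k j} → suc k ≡ p * suc j → p ∣ suc k
  boundary-divisible {j = j} k+1≡p[j+1] = divides (suc j) (trans k+1≡p[j+1] (*-comm p (suc j)))

  unitCount-multiple : ∀ j → unitCount (p * j) ≡ (p ∸ 1) * j
  unitCount-multiple j = begin
    unitCount (p * j)          ≡⟨ m+n∸n≡m (unitCount (p * j)) j ⟨
    unitCount (p * j) + j ∸ j  ≡⟨ cong (_∸ j) (blockInduction Counted refl inside boundary j) ⟩
    p * j ∸ j                  ≡⟨ cong (p * j ∸_) (*-identityˡ j) ⟨
    p * j ∸ 1 * j              ≡⟨ *-distribʳ-∸ j p 1 ⟨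
    (p ∸ 1) * j                ∎
    where
    open ≡-Reasoning
    Counted : ℕ → ℕ → Set
    Counted k j = unitCount k + j ≡ k
    inside : ∀ {k j} → ¬ p ∣ suc k → Counted k j → Counted (suc k) j
    inside {j = j} p∤ counted = trans (cong (_+ j) (unitCount-take p∤)) (cong suc counted)
    boundary : ∀ {k j} → suc k ≡ p * suc j → Counted k j → Counted (suc k) (suc j)
    boundary {k} {j} k+1≡p[j+1] counted =
      trans (cong (_+ suc j) (unitCount-skip (boundary-divisible k+1≡p[j+1])))
            (trans (+-suc (unitCount k) j) (cong suc counted))

  -- Both sides are followed along k = 0, …, pj; a step onto a non-multiple of p
  -- multiplies both by (pH-1-k)/(k+1), a step onto p(j+1) multiplies both by
  -- (H-j-1)/(j+1).
  choose-block : ∀ H j → ((p * H ∸ 1) C (p * j)) * unitProduct id (p * j)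
                         ≡ ((H ∸ 1) C j) * unitProduct (p * H ∸_) (p * j)
  choose-block H = blockInduction Splits refl (λ {k} {j} → inside {k} {j}) boundary
    where
    n : ℕ
    n = p * H
    c : ℕ → ℕ
    c k = (n ∸ 1) C k
    d : ℕ → ℕ
    d j = (H ∸ 1) C j
    A : ℕ → ℕ
    A = unitProduct id
    B : ℕ → ℕ
    B = unitProduct (n ∸_)
    Splits : ℕ → ℕ → Set
    Splits k j = c k * A k ≡ d j * B k

    inside : ∀ {k j} → ¬ p ∣ suc k → Splits k j → Splits (suc k) j
    inside {k} {j} p∤ splits = begin
      c (suc k) * A (suc k)            ≡⟨ cong (c (suc k) *_) (unitProduct-take id p∤) ⟩
      c (suc k) * (A k * suc k)        ≡⟨ regroup₁ (c (suc k)) (A k) (suc k) ⟩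
      (suc k * c (suc k)) * A k        ≡⟨ cong (_* A k) (choose-absorption (n ∸ 1) k) ⟩
      ((n ∸ 1 ∸ k) * c k) * A k        ≡⟨ *-assoc (n ∸ 1 ∸ k) (c k) (A k) ⟩
      (n ∸ 1 ∸ k) * (c k * A k)        ≡⟨ cong ((n ∸ 1 ∸ k) *_) splits ⟩
      (n ∸ 1 ∸ k) * (d j * B k)        ≡⟨ regroup₂ (n ∸ 1 ∸ k) (d j) (B k) ⟩
      d j * (B k * (n ∸ 1 ∸ k))        ≡⟨ cong (λ z → d j * (B k * z)) (∸-+-assoc n 1 k) ⟩
      d j * (B k * (n ∸ suc k))        ≡⟨ cong (d j *_) (unitProduct-take (n ∸_) p∤) ⟨
      d j * B (suc k)                  ∎
      where
      open ≡-Reasoning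
      regroup₁ : ∀ c a s → c * (a * s) ≡ (s * c) * a
      regroup₁ = solve-∀
      regroup₂ : ∀ t d b → t * (d * b) ≡ d * (b * t)
      regroup₂ = solve-∀

    boundary : ∀ {k j} → suc k ≡ p * suc j → Splits k j → Splits (suc k) (suc j)
    boundary {k} {j} k+1≡p[j+1] splits = *-cancelˡ-≡ _ _ (suc j) (begin
      suc j * (c (suc k) * A (suc k))  ≡⟨ cong (λ z → suc j * (c (suc k) * z)) (unitProduct-skip id p∣) ⟩
      suc j * (c (suc k) * A k)        ≡⟨ *-assoc (suc j) (c (suc k)) (A k) ⟨
      (suc j * c (suc k)) * A k        ≡⟨ cong (_* A k) absorb-n ⟩
      ((H ∸ suc j) * c k) * A k        ≡⟨ *-assoc (H ∸ suc j) (c k) (A k) ⟩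
      (H ∸ suc j) * (c k * A k)        ≡⟨ cong ((H ∸ suc j) *_) splits ⟩
      (H ∸ suc j) * (d j * B k)        ≡⟨ *-assoc (H ∸ suc j) (d j) (B k) ⟨
      ((H ∸ suc j) * d j) * B k        ≡⟨ cong (_* B k) absorb-H ⟨
      (suc j * d (suc j)) * B k        ≡⟨ *-assoc (suc j) (d (suc j)) (B k) ⟩
      suc j * (d (suc j) * B k)        ≡⟨ cong (λ z → suc j * (d (suc j) * z)) (unitProduct-skip (n ∸_) p∣) ⟨
      suc j * (d (suc j) * B (suc k))  ∎)
      where
      open ≡-Reasoning
      p∣ : p ∣ suc k
      p∣ = boundary-divisible k+1≡p[j+1]
      absorb-H : suc j * d (suc j) ≡ (H ∸ suc j) * d j
      absorb-H = trans (choose-absorption (H ∸ 1) j) (cong (_* d j) (∸-+-assoc H 1 j))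
      -- (k+1)·C(n-1,k+1) = (n-1-k)·C(n-1,k), with k+1 = p(j+1) and n-1-k = p(H-j-1).
      absorb-n : suc j * c (suc k) ≡ (H ∸ suc j) * c k
      absorb-n = *-cancelˡ-≡ _ _ p (begin
        p * (suc j * c (suc k))    ≡⟨ *-assoc p (suc j) (c (suc k)) ⟨
        (p * suc j) * c (suc k)    ≡⟨ cong (_* c (suc k)) k+1≡p[j+1] ⟨
        suc k * c (suc k)          ≡⟨ choose-absorption (n ∸ 1) k ⟩
        (n ∸ 1 ∸ k) * c k          ≡⟨ cong (_* c k) (trans (∸-+-assoc n 1 k) (cong (n ∸_) k+1≡p[j+1])) ⟩
        (p * H ∸ p * suc j) * c k  ≡⟨ cong (_* c k) (*-distribˡ-∸ p H (suc j)) ⟨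
        (p * (H ∸ suc j)) * c k    ≡⟨ *-assoc p (H ∸ suc j) (c k) ⟩
        p * ((H ∸ suc j) * c k)    ∎)

parity : ∀ n → 2 ∣ n ⊎ 2 ∣ suc n
parity zero    = inj₁ (divides 0 refl)
parity (suc n) with parity n
... | inj₁ (divides q n≡q*2) = inj₂ (divides (suc q) (cong (λ m → suc (suc m)) n≡q*2))
... | inj₂ 2∣n+1             = inj₁ 2∣n+1

odd-prime : ∀ {p} → Prime p → 3 ≤ p → 2 ∣ p ∸ 1
odd-prime {suc p-1} p-prime 3≤p with parity p-1
... | inj₁ 2∣p-1 = 2∣p-1
... | inj₂ 2∣p   = ⊥-elim (Prime.notComposite p-prime (composite 3≤p 2∣p))

minus-one^even : ∀ {n} → 2 ∣ n → -1ℤ ℤ.^ n ≡ 1ℤ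
minus-one^even (divides t refl) =
  trans (cong (-1ℤ ℤ.^_) (*-comm t 2)) (trans (sym (ℤProp.^-*-assoc -1ℤ 2 t)) (ℤProp.^-zeroˡ t))

D : ℕ → ℕ → ℕ
D p g = (p ^ suc g ∸ 1) C (p ^ g)

module _ {p : ℕ} (p-prime : Prime p) where
  private instance
    p≢0 : NonZero p
    p≢0 = prime⇒nonZero p-prime
  open UnitProducts p
  open Blocks p

  unitProduct-coprime : ∀ k → ¬ p ∣ unitProduct id k
  unitProduct-coprime zero    p∣1 = nonTrivial⇒≢1 {{prime⇒nonTrivial p-prime}} (ℕ.∣1⇒≡1 p∣1)
  unitProduct-coprime (suc k) with p ∣? suc k
  ... | yes _  = unitProduct-coprime k
  ... | no p∤k+1 = λ p∣ → [ unitProduct-coprime k , p∤k+1 ]′ (euclidsLemma _ _ p-prime p∣)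

  -- D(g+1) ≡ (-1)^((p-1)p^g) · D(g)  (mod p²): split C(p·q - 1, q) for q = p^(g+1)
  -- by choose-block, reduce its unit factors modulo p² | pq, and cancel ∏' i.
  D-step : ∀ g → + D p (suc g) ≡ᶻ -1ℤ ℤ.^ ((p ∸ 1) * p ^ g) ℤ.* + D p g [mod p ^ 2 ]
  D-step g = ≡ᶻ-cancel {e = 2} p-prime (unitProduct-coprime q) (≡ᶻ-trans (≡ᶻ-reflexive split) reduced)
    where
    q n : ℕ
    q = p ^ suc g
    n = p * q
    s : ℤ
    s = -1ℤ ℤ.^ ((p ∸ 1) * p ^ g)
    A B : ℕ
    A = unitProduct id q
    B = unitProduct (n ∸_) q
    -- choose-block with H = p^(g+1), j = p^g, read in ℤ
    split : + A ℤ.* + D p (suc g) ≡ + D p g ℤ.* + B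
    split = trans (sym (ℤProp.pos-* A (D p (suc g))))
                  (trans (cong +_ (trans (*-comm A _) (choose-block q (p ^ g)))) (ℤProp.pos-* (D p g) B))
    p²∣n : p ^ 2 ∣ n
    p²∣n = ℕ.*-monoʳ-∣ p (ℕ.*-monoʳ-∣ p (ℕ.1∣ (p ^ g)))
    -- every factor pq - i of B is ≡ -i, and (p-1)p^g of them are taken
    units : + B ≡ᶻ s ℤ.* + A [mod p ^ 2 ]
    units = subst (λ c → + B ≡ᶻ -1ℤ ℤ.^ c ℤ.* + A [mod p ^ 2 ]) (unitCount-multiple (p ^ g))
                  (negate-factors (n ∸_) id q (λ i i≤q → complement-≡ᶻ p²∣n (≤-trans i≤q (m≤n*m q p))))
    regroup : ∀ d s a → d ℤ.* (s ℤ.* a) ≡ a ℤ.* (s ℤ.* d)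
    regroup = ℤRing.solve-∀
    reduced : + D p g ℤ.* + B ≡ᶻ + A ℤ.* (s ℤ.* + D p g) [mod p ^ 2 ]
    reduced = ≡ᶻ-trans (≡ᶻ-*-cong (≡ᶻ-reflexive {x = + D p g} refl) units) (≡ᶻ-reflexive (regroup (+ D p g) s (+ A)))

  D-stable : ∀ g → 2 ∣ (p ∸ 1) * p ^ g → + D p (suc g) ≡ᶻ + D p g [mod p ^ 2 ]
  D-stable g even = ≡ᶻ-trans (D-step g)
    (≡ᶻ-reflexive (trans (cong (ℤ._* + D p g) (minus-one^even even)) (ℤProp.*-identityˡ (+ D p g))))

  -- For odd p the sign is always +1, so D(g) ≡ D(0) = C(p-1, 1) = p - 1.
  D-odd : 2 ∣ p ∸ 1 → ∀ g → + D p g ≡ᶻ + (p ∸ 1) [mod p ^ 2 ]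
  D-odd _     zero    = ≡ᶻ-reflexive (cong +_ (trans (nC1≡n (p * 1 ∸ 1)) (cong (_∸ 1) (*-identityʳ p))))
  D-odd 2∣p-1 (suc g) = ≡ᶻ-trans (D-stable g (ℕ.∣m⇒∣m*n (p ^ g) 2∣p-1)) (D-odd 2∣p-1 g)

-- For p = 2 the sign is +1 from g = 1 on, so D(g+1) ≡ D(1) = C(3, 2) = 3 (mod 4).
D-two : ∀ g → + D 2 (suc g) ≡ᶻ + 3 [mod 4 ]
D-two zero    = ≡ᶻ-reflexive refl
D-two (suc g) = ≡ᶻ-trans (D-stable prime[2] (suc g) (ℕ.∣n⇒∣m*n 1 (ℕ.m∣m*n (2 ^ g)))) (D-two g)

lemma2p1 : ∀ (p f : ℕ) → Prime p → 2 ≤ f →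
           (3 ≤ p → ((p ^ f) ∸ 1) C (p ^ (f ∸ 1)) ≡ p ∸ 1 [mod p ^ 2 ]) ×
           (p ≡ 2 → ((2 ^ f) ∸ 1) C (2 ^ (f ∸ 1)) ≡ 3 [mod 4 ])
lemma2p1 p (suc (suc g)) p-prime (s≤s (s≤s z≤n)) =
  (λ 3≤p → ≡ᶻ⇒≡[mod] (D-odd p-prime (odd-prime p-prime 3≤p) (suc g))) ,
  (λ { refl → ≡ᶻ⇒≡[mod] (D-two g) })
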